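{- Let $X$ be a connected graph without loops and multiple edges. The topological space $(VX\cup\Omega_{\mathrm{E}}X,\tau_{\mathrm{E}}X)$ is compact.
   Context: For $e\subseteq VX$ write $e^{*}=VX\setminus e$. The edge-boundary $\delta e$ is the set of edges joining a vertex of $e$ to a vertex of $e^{*}$. An edge-cut is a nonempty set $e\subseteq VX$ with $\delta e$ finite. A ray is a sequence $(x_n)_{n\in\mathbb N}$ of pairwise distinct vertices with $x_n$ adjacent to $x_{n+1}$ for all $n$. A ray lies in $e$ if all but finitely many of its vertices belong to $e$. Two rays are separated by $e$ if one lies in $e$ and the other in $e^{*}$. Two rays are edge-equivalent if no edge-cut separates them; the equivalence classes are the edge-ends of $X$. An edge-end lies in $e$ if all its rays lie in $e$; $\Omega_{\mathrm{E}}e$ is the set of edge-ends lying in $e$, and $\Omega_{\mathrm{E}}X=\Omega_{\mathrm{E}}VX$. The edge-topology $\tau_{\mathrm{E}}X$ on $VX\cup\Omega_{\mathrm{E}}X$ is the topology generated by the base $B_{\mathrm{E}}X=\{e\cup\Omega_{\mathrm{E}}e\mid e\subseteq VX,\ |\delta e|<\infty\}$. -}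

module Defs where

open import Level using (0ℓ; Lift)
open import Data.Nat using (ℕ; suc; _≤_)
open import Data.Product using (Σ; ∃; _×_; _,_)
open import Data.Sum using (_⊎_; inj₁; inj₂)
open import Data.List using (List)
open import Data.List.Membership.Propositional using (_∈_)
open import Data.List.Relation.Unary.Any using (Any)
open import Relation.Nullary using (¬_)
open import Relation.Binary.PropositionalEquality using (_≡_)

-- A graph without loops and multiple edges: a symmetric, irreflexive,
-- proof-irrelevant (at most one edge between two vertices) adjacency relation.
record Graph : Set₁ where
  field
    V      : Set
    _~_    : V → V → Set
    ~-sym  : ∀ {x y} → x ~ y → y ~ x
    ~-irr  : ∀ x → ¬ (x ~ x)
    ~-prop : ∀ {x y} (p q : x ~ y) → p ≡ q

module _ (X : Graph) where
  open Graph X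

  data Walk : V → V → Set where
    stop : ∀ {x} → Walk x x
    step : ∀ {x y z} → x ~ y → Walk y z → Walk x z

  Connected : Set
  Connected = ∀ x y → Walk x y

  VSet : Set₁
  VSet = V → Set

  _* : VSet → VSet
  (e *) v = ¬ e v

  -- the edge boundary δe is finite: there is a finite list containing
  -- (as oriented pairs (x , y) with x ∈ e, y ∈ e*) every edge of δe
  FiniteBoundary : VSet → Set
  FiniteBoundary e =
    Σ (List (V × V)) λ L → ∀ x y → x ~ y → e x → (e *) y → (x , y) ∈ L

  EdgeCut : VSet → Set
  EdgeCut e = (∃ λ v → e v) × FiniteBoundary e

  record Ray : Set where
    field
      vtx : ℕ → V
      inj : ∀ m n → vtx m ≡ vtx n → m ≡ n
      adj : ∀ n → vtx n ~ vtx (suc n)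
  open Ray public

  LiesIn : Ray → VSet → Set
  LiesIn r e = ∃ λ N → ∀ n → N ≤ n → e (vtx r n)

  Separates : VSet → Ray → Ray → Set
  Separates e r s = (LiesIn r e × LiesIn s (e *)) ⊎ (LiesIn r (e *) × LiesIn s e)

  EdgeEquiv : Ray → Ray → Set₁
  EdgeEquiv r s = ∀ e → EdgeCut e → ¬ Separates e r s

  EndIn : Ray → VSet → Set₁
  EndIn r e = ∀ s → EdgeEquiv r s → LiesIn s e

  -- points of VX ∪ Ω_E X: a vertex, or an edge-end represented by a ray
  -- (two rays represent the same point iff EdgeEquiv)
  Point : Set
  Point = V ⊎ Ray

  InBasic : VSet → Point → Set₁
  InBasic e (inj₁ v) = Lift _ (e v)
  InBasic e (inj₂ r) = EndIn r e

  IsOpen : (Point → Set₁) → Set₁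
  IsOpen U = ∀ p → U p →
    Σ VSet λ e → FiniteBoundary e × InBasic e p × (∀ q → InBasic e q → U q)

  EdgeTopologyCompact : Set₂
  EdgeTopologyCompact =
    (I : Set) (U : I → Point → Set₁) →
    (∀ i → IsOpen (U i)) →
    (∀ p → ∃ λ i → U i p) →
    Σ (List I) λ is → ∀ p → Any (λ i → U i p) is

-- Suppose an open cover has no finite subcover. Exhaust X by finitely covered
-- sets Ball₀ ⊆ Ball₁ ⊆ … with finite boundary, Ball_{k+1} adding a basic
-- neighbourhood of every vertex just outside Ball_k. Removing Ball_k from a
-- connected uncovered set with finite boundary leaves finitely many
-- components, one of which is again uncovered; this yields nested connected
-- uncovered sets C_k with C_{k+1} disjoint from Ball_k. Walking greedily into
-- ever deeper C_k produces a ray lying eventually in every C_k. A basic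
-- neighbourhood e of its end has finite boundary, which some C_K misses; as
-- C_K is connected and meets e, it lies inside e and so is covered by a
-- single member of the cover, a contradiction.

module Submission where

open import Defs
open import Level using (0ℓ; lift) renaming (suc to lsuc)
open import Axiom.ExcludedMiddle using (ExcludedMiddle)
open import Axiom.DoubleNegationElimination using (em⇒dne)
open import Data.Empty using (⊥; ⊥-elim)
open import Data.Unit using (tt)
open import Data.Nat using (ℕ; zero; suc; _+_; _≤_; _<_; _>_; z≤n; s≤s; _≤?_)
open import Data.Nat.Properties
open import Data.Nat.GeneralisedArithmetic using (fold)
open import Data.Nat.Induction using (<-wellFounded)
open import Induction.WellFounded using (Acc; acc)
open import Data.Product using (Σ; ∃; ∃₂; _×_; _,_; proj₁; proj₂; swap)
open import Data.Product.Relation.Binary.Lex.Strict using (×-Lex; ×-transitive; ×-irreflexive)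
open import Data.Sum using (_⊎_; inj₁; inj₂; [_,_])
open import Data.List using (List; []; _∷_; _++_; map)
open import Data.List.Membership.Propositional using (_∈_; _∉_)
open import Data.List.Membership.Propositional.Properties using (∈-map⁺; ∈-++⁺ˡ; ∈-++⁺ʳ)
open import Data.List.Relation.Unary.Any using (Any; here; there)
open import Data.List.Relation.Unary.Any.Properties using (++⁺ˡ; ++⁺ʳ)
open import Function using (_on_; id)
open import Relation.Binary.Core using (Rel)
open import Relation.Binary.Definitions using (Transitive; Irreflexive; tri<; tri≈; tri>)
open import Relation.Binary.PropositionalEquality
  using (_≡_; _≢_; refl; sym; trans; subst; isEquivalence)
open import Relation.Nullary using (¬_; yes; no)
open import Relation.Unary using (Pred; _⊆_; _∪_; _∩_; _∖_; ∁; ∅; U)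

inductionFrom : ∀ {ℓ} (P : ℕ → Set ℓ) {b} → P b → (∀ {n} → b ≤ n → P n → P (suc n)) →
                ∀ {n} → b ≤ n → P n
inductionFrom P pb ind {zero} z≤n = pb
inductionFrom P pb ind {suc n} b≤1+n with m≤n⇒m<n∨m≡n b≤1+n
... | inj₁ b<1+n = ind (≤-pred b<1+n) (inductionFrom P pb ind (≤-pred b<1+n))
... | inj₂ refl = pb

antitone : {A : Set} (C : ℕ → Pred A 0ℓ) → (∀ k → C (suc k) ⊆ C k) →
           ∀ {k k′} → k ≤ k′ → C k′ ⊆ C k
antitone C shrinks {k} = inductionFrom (λ n → C n ⊆ C k) id (λ {n} _ sub c → sub (shrinks n c))

module Search (em : ExcludedMiddle 0ℓ) where

  lastBefore : (P : ℕ → Set) → P 0 → ∀ n → ¬ P n → ∃ λ m → P m × ¬ P (suc m)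
  lastBefore P p₀ zero ¬p₀ = ⊥-elim (¬p₀ p₀)
  lastBefore P p₀ (suc n) ¬pₙ₊₁ with em {P n}
  ... | yes pₙ = n , pₙ , ¬pₙ₊₁
  ... | no ¬pₙ = lastBefore P p₀ n ¬pₙ

  least : (P : ℕ → Set) → ∀ n → P n → ∃ λ m → P m × (∀ {k} → k < m → ¬ P k)
  least P n = go n (<-wellFounded n)
    where
    go : ∀ n → Acc _<_ n → P n → ∃ λ m → P m × (∀ {k} → k < m → ¬ P k)
    go n (acc smaller) pₙ with em {∃ λ k → k < n × P k}
    ... | yes (k , k<n , pₖ) = go k (smaller k<n) pₖ
    ... | no none = n , pₙ , λ k<n pₖ → none (_ , k<n , pₖ)

module ClassicalGraph (em : ExcludedMiddle 0ℓ) (X : Graph) where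
  open Graph X
  open Search em

  private
    dne : ∀ {P : Set} → ¬ ¬ P → P
    dne = em⇒dne em

  -- Finite boundaries

  innerBoundary : ∀ {e} → FiniteBoundary X e → List V
  innerBoundary (L , _) = map proj₁ L

  outerBoundary : ∀ {e} → FiniteBoundary X e → List V
  outerBoundary (L , _) = map proj₂ L

  innerBoundary-∈ : ∀ {e} (b : FiniteBoundary X e) {x y} → x ~ y → e x → ¬ e y →
                    x ∈ innerBoundary b
  innerBoundary-∈ (L , bd) x~y ex ¬ey = ∈-map⁺ proj₁ (bd _ _ x~y ex ¬ey)

  outerBoundary-∈ : ∀ {e} (b : FiniteBoundary X e) {x y} → x ~ y → e x → ¬ e y →
                    y ∈ outerBoundary b
  outerBoundary-∈ (L , bd) x~y ex ¬ey = ∈-map⁺ proj₂ (bd _ _ x~y ex ¬ey)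

  FiniteBoundary-∁ : ∀ {e} → FiniteBoundary X e → FiniteBoundary X (∁ e)
  FiniteBoundary-∁ (L , bd) =
    map swap L , λ x y x~y ¬ex ¬¬ey → ∈-map⁺ swap (bd y x (~-sym x~y) (dne ¬¬ey) ¬ex)

  FiniteBoundary-∪ : ∀ {A B} → FiniteBoundary X A → FiniteBoundary X B →
                     FiniteBoundary X (A ∪ B)
  FiniteBoundary-∪ {A} {B} (L , bdA) (M , bdB) = L ++ M , bd
    where
    bd : ∀ x y → x ~ y → (A ∪ B) x → ¬ (A ∪ B) y → (x , y) ∈ L ++ M
    bd x y x~y (inj₁ ax) ¬y = ∈-++⁺ˡ (bdA x y x~y ax (λ ay → ¬y (inj₁ ay)))
    bd x y x~y (inj₂ bx) ¬y = ∈-++⁺ʳ L (bdB x y x~y bx (λ by → ¬y (inj₂ by)))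

  FiniteBoundary-∩ : ∀ {A B} → FiniteBoundary X A → FiniteBoundary X B →
                     FiniteBoundary X (A ∩ B)
  FiniteBoundary-∩ {A} {B} (L , bdA) (M , bdB) = L ++ M , bd
    where
    bd : ∀ x y → x ~ y → (A ∩ B) x → ¬ (A ∩ B) y → (x , y) ∈ L ++ M
    bd x y x~y (ax , bx) ¬y with em {A y}
    ... | no ¬ay = ∈-++⁺ˡ (bdA x y x~y ax ¬ay)
    ... | yes ay = ∈-++⁺ʳ L (bdB x y x~y bx (λ by → ¬y (ay , by)))

  ⋃ᴸ : {J : Set} → (J → Pred V 0ℓ) → List J → Pred V 0ℓ
  ⋃ᴸ f [] = ∅
  ⋃ᴸ f (j ∷ js) = f j ∪ ⋃ᴸ f js

  ∈-⋃ᴸ : ∀ {J : Set} (f : J → Pred V 0ℓ) {j js} → j ∈ js → f j ⊆ ⋃ᴸ f js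
  ∈-⋃ᴸ f (here refl) x = inj₁ x
  ∈-⋃ᴸ f (there j∈js) x = inj₂ (∈-⋃ᴸ f j∈js x)

  FiniteBoundary-⋃ᴸ : ∀ {J : Set} (f : J → Pred V 0ℓ) → (∀ j → FiniteBoundary X (f j)) →
                      ∀ js → FiniteBoundary X (⋃ᴸ f js)
  FiniteBoundary-⋃ᴸ f b [] = [] , λ _ _ _ ()
  FiniteBoundary-⋃ᴸ f b (j ∷ js) = FiniteBoundary-∪ (b j) (FiniteBoundary-⋃ᴸ f b js)

  -- Rays and ends

  LiesIn-witness : ∀ (r : Ray X) {A} → LiesIn X r A → ∃ A
  LiesIn-witness r (N , p) = vtx r N , p N ≤-refl

  LiesIn-mono : ∀ (r : Ray X) {A B} → A ⊆ B → LiesIn X r A → LiesIn X r B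
  LiesIn-mono r A⊆B (N , p) = N , λ n N≤n → A⊆B (p n N≤n)

  LiesIn-∩ : ∀ (r : Ray X) {A B} → LiesIn X r A → LiesIn X r B → LiesIn X r (A ∩ B)
  LiesIn-∩ r (M , p) (N , q) =
    M + N , λ n M+N≤n → p n (≤-trans (m≤m+n M N) M+N≤n) , q n (≤-trans (m≤n+m N M) M+N≤n)

  LiesIn-∁ : ∀ (r : Ray X) {A} → LiesIn X r A → ¬ LiesIn X r (∁ A)
  LiesIn-∁ r {A} a ∁a with LiesIn-witness r {A ∩ ∁ A} (LiesIn-∩ r {A} {∁ A} a ∁a)
  ... | _ , x , ¬x = ¬x x

  LiesIn-≢ : ∀ (r : Ray X) a → LiesIn X r (_≢ a)
  LiesIn-≢ r a with em {∃ λ n → vtx r n ≡ a}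
  ... | yes (m , vₘ≡a) = suc m , λ n m<n vₙ≡a → <-irrefl (inj r m n (trans vₘ≡a (sym vₙ≡a))) m<n
  ... | no ¬hit = 0 , λ n _ vₙ≡a → ¬hit (n , vₙ≡a)

  LiesIn-∉ : ∀ (r : Ray X) L → LiesIn X r (_∉ L)
  LiesIn-∉ r [] = 0 , λ _ _ ()
  LiesIn-∉ r (a ∷ L) =
    LiesIn-mono r (λ {v} → ∉-∷ {v}) (LiesIn-∩ r {_≢ a} {_∉ L} (LiesIn-≢ r a) (LiesIn-∉ r L))
    where
    ∉-∷ : ∀ {v} → v ≢ a × v ∉ L → v ∉ a ∷ L
    ∉-∷ (v≢a , _) (here v≡a) = v≢a v≡a
    ∉-∷ (_ , v∉L) (there v∈L) = v∉L v∈L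

  -- Past the last inner boundary vertex it meets, a ray never crosses δe again.
  ray-side : ∀ (r : Ray X) {e} → FiniteBoundary X e → LiesIn X r e ⊎ LiesIn X r (∁ e)
  ray-side r {e} b with LiesIn-∉ r (innerBoundary b)
  ... | N , avoids with em {e (vtx r N)}
  ... | yes eN = inj₁ (N , λ n → inductionFrom (λ n → e (vtx r n)) eN stays)
    where
    stays : ∀ {n} → N ≤ n → e (vtx r n) → e (vtx r (suc n))
    stays {n} N≤n eₙ = dne λ ¬eₙ₊₁ → avoids n N≤n (innerBoundary-∈ b (adj r n) eₙ ¬eₙ₊₁)
  ... | no ¬eN = inj₂ (N , λ n → inductionFrom (λ n → ¬ e (vtx r n)) ¬eN stays)
    where
    stays : ∀ {n} → N ≤ n → ¬ e (vtx r n) → ¬ e (vtx r (suc n))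
    stays {n} N≤n ¬eₙ eₙ₊₁ =
      avoids (suc n) (m≤n⇒m≤1+n N≤n) (innerBoundary-∈ b (~-sym (adj r n)) eₙ₊₁ ¬eₙ)

  EdgeEquiv-refl : ∀ r → EdgeEquiv X r r
  EdgeEquiv-refl r e _ (inj₁ (re , r∁e)) = LiesIn-∁ r {e} re r∁e
  EdgeEquiv-refl r e _ (inj₂ (r∁e , re)) = LiesIn-∁ r {e} re r∁e

  EdgeEquiv-LiesIn : ∀ {r s e} → EdgeEquiv X r s → FiniteBoundary X e →
                     LiesIn X r e → LiesIn X s e
  EdgeEquiv-LiesIn {r} {s} {e} r≃s b re =
    [ id , (λ s∁e → ⊥-elim (r≃s _ (LiesIn-witness r {e} re , b) (inj₁ (re , s∁e)))) ]
      (ray-side s {e} b)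

  EndIn⇒LiesIn : ∀ r {A} → EndIn X r A → LiesIn X r A
  EndIn⇒LiesIn r end = end r (EdgeEquiv-refl r)

  EndIn-mono : ∀ r {A B} → A ⊆ B → EndIn X r A → EndIn X r B
  EndIn-mono r {A} {B} A⊆B end s r≃s = LiesIn-mono s {A} {B} A⊆B (end s r≃s)

  EndIn-∩ : ∀ r {A B} → EndIn X r A → EndIn X r B → EndIn X r (A ∩ B)
  EndIn-∩ r {A} {B} endA endB s r≃s = LiesIn-∩ s {A} {B} (endA s r≃s) (endB s r≃s)

  end-side : ∀ r {e} → FiniteBoundary X e → EndIn X r e ⊎ EndIn X r (∁ e)
  end-side r {e} b with ray-side r {e} b
  ... | inj₁ re = inj₁ λ s r≃s → EdgeEquiv-LiesIn {r} {s} {e} r≃s b re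
  ... | inj₂ r∁e = inj₂ λ s r≃s → EdgeEquiv-LiesIn {r} {s} {∁ e} r≃s (FiniteBoundary-∁ b) r∁e

  -- Walks inside a vertex set

  data WalkIn (A : Pred V 0ℓ) : V → V → Set where
    stop : ∀ {x} → A x → WalkIn A x x
    step : ∀ {x y z} → A x → x ~ y → WalkIn A y z → WalkIn A x z

  module _ {A : Pred V 0ℓ} where

    WalkIn-source : ∀ {x y} → WalkIn A x y → A x
    WalkIn-source (stop ax) = ax
    WalkIn-source (step ax _ _) = ax

    WalkIn-target : ∀ {x y} → WalkIn A x y → A y
    WalkIn-target (stop ax) = ax
    WalkIn-target (step _ _ w) = WalkIn-target w

    WalkIn-snoc : ∀ {x y z} → WalkIn A x y → y ~ z → A z → WalkIn A x z
    WalkIn-snoc (stop ax) x~z az = step ax x~z (stop az)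
    WalkIn-snoc (step ax x~y w) y~z az = step ax x~y (WalkIn-snoc w y~z az)

    WalkIn-++ : ∀ {x y z} → WalkIn A x y → WalkIn A y z → WalkIn A x z
    WalkIn-++ (stop _) w′ = w′
    WalkIn-++ (step ax x~y w) w′ = step ax x~y (WalkIn-++ w w′)

    WalkIn-reverse : ∀ {x y} → WalkIn A x y → WalkIn A y x
    WalkIn-reverse (stop ax) = stop ax
    WalkIn-reverse (step ax x~y w) = WalkIn-snoc (WalkIn-reverse w) (~-sym x~y) ax

  WalkIn-mono : ∀ {A B} → A ⊆ B → ∀ {x y} → WalkIn A x y → WalkIn B x y
  WalkIn-mono A⊆B (stop ax) = stop (A⊆B ax)
  WalkIn-mono A⊆B (step ax x~y w) = step (A⊆B ax) x~y (WalkIn-mono A⊆B w)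

  Walk⇒WalkIn : ∀ {x y} → Walk X x y → WalkIn U x y
  Walk⇒WalkIn stop = stop tt
  Walk⇒WalkIn (step x~y w) = step tt x~y (Walk⇒WalkIn w)

  crossing : ∀ {Q P : Pred V 0ℓ} {a b} → WalkIn Q a b → P a → ¬ P b →
             ∃₂ λ u w → WalkIn (Q ∩ P) a u × u ~ w × ¬ P w
  crossing (stop _) pa ¬pb = ⊥-elim (¬pb pa)
  crossing {P = P} (step {y = y} qa a~y w) pa ¬pb with em {P y}
  ... | no ¬py = _ , y , stop (qa , pa) , a~y , ¬py
  ... | yes py with crossing w py ¬pb
  ... | u , w′ , path , u~w′ , ¬pw′ = u , w′ , step (qa , pa) a~y path , u~w′ , ¬pw′

  IsConnected : Pred V 0ℓ → Set
  IsConnected C = ∀ {a b} → C a → C b → WalkIn C a b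

  connected-⊆ : ∀ {C e} → IsConnected C → (b : FiniteBoundary X e) →
                (∀ {v} → C v → v ∉ innerBoundary b) → ∀ {a} → C a → e a → C ⊆ e
  connected-⊆ {C} {e} connC b avoids ca ea {v} cv = dne escape
    where
    escape : ¬ ¬ e v
    escape ¬ev with crossing (connC ca cv) ea ¬ev
    ... | u , w , path , u~w , ¬ew with WalkIn-target path
    ...   | cu , eu = avoids cu (innerBoundary-∈ b u~w eu ¬ew)

  Component : Pred V 0ℓ → V → Pred V 0ℓ
  Component A u = WalkIn A u

  Component-⊆ : ∀ {A u} → Component A u ⊆ A
  Component-⊆ = WalkIn-target

  FiniteBoundary-Component : ∀ {A u} → FiniteBoundary X A → FiniteBoundary X (Component A u)
  FiniteBoundary-Component (L , bd) =
    L , λ x y x~y ux ¬uy → bd x y x~y (WalkIn-target ux) (λ ay → ¬uy (WalkIn-snoc ux x~y ay))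

  Component-connected : ∀ {A u} → IsConnected (Component A u)
  Component-connected {A} {u} ua ub = within ua (WalkIn-++ (WalkIn-reverse ua) ub)
    where
    within : ∀ {a b} → Component A u a → WalkIn A a b → WalkIn (Component A u) a b
    within ua (stop _) = stop ua
    within ua (step _ a~y w) = step ua a~y (within (WalkIn-snoc ua a~y (WalkIn-source w)) w)

  ⊆-⋃-Component : Connected X → ∀ {A r} (b : FiniteBoundary X A) → ¬ A r →
                  A ⊆ ⋃ᴸ (Component A) (innerBoundary b)
  ⊆-⋃-Component conn {A} {r} b ¬ar {v} av with crossing (Walk⇒WalkIn (conn v r)) av ¬ar
  ... | u , w , path , u~w , ¬aw =
    ∈-⋃ᴸ (Component A) (innerBoundary-∈ b u~w (proj₂ (WalkIn-target path)) ¬aw)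
      (WalkIn-reverse (WalkIn-mono proj₂ path))

  -- A ray through a nested sequence of connected sets

  data Reaches (A B : Pred V 0ℓ) : ℕ → V → Set where
    arrive : ∀ {v} → B v → Reaches A B 0 v
    advance : ∀ {v w n} → A v → v ~ w → Reaches A B n w → Reaches A B (suc n) v

  WalkIn⇒Reaches : ∀ {A B x y} → WalkIn A x y → B y → ∃ λ n → Reaches A B n x
  WalkIn⇒Reaches (stop _) by = 0 , arrive by
  WalkIn⇒Reaches (step ax x~z w) by with WalkIn⇒Reaches w by
  ... | n , reaches = suc n , advance ax x~z reaches

  Reaches-source : ∀ {A B n v} → B ⊆ A → Reaches A B n v → A v
  Reaches-source B⊆A (arrive bv) = B⊆A bv
  Reaches-source B⊆A (advance av _ _) = av

  Reaches-advance : ∀ {A B n v} → Reaches A B n v → ¬ B v →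
                    Σ V λ w → v ~ w × ∃ λ m → suc m ≡ n × Reaches A B m w
  Reaches-advance (arrive bv) ¬bv = ⊥-elim (¬bv bv)
  Reaches-advance (advance _ v~w reaches) _ = _ , v~w , _ , refl , reaches

  module Orbit {ℓ} {_≺_ : Rel V ℓ} (≺-trans : Transitive _≺_) (≺-irrefl : Irreflexive _≡_ _≺_)
               (f : V → V) (~f : ∀ v → v ~ f v) (≺f : ∀ v → v ≺ f v) (x : V) where

    orbit : ℕ → V
    orbit = fold x f

    orbit-increasing : ∀ {m n} → m < n → orbit m ≺ orbit n
    orbit-increasing {m} =
      inductionFrom (λ n → orbit m ≺ orbit n) (≺f (orbit m)) (λ _ m≺n → ≺-trans m≺n (≺f _))

    orbit-injective : ∀ m n → orbit m ≡ orbit n → m ≡ n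
    orbit-injective m n eq with <-cmp m n
    ... | tri< m<n _ _ = ⊥-elim (≺-irrefl eq (orbit-increasing m<n))
    ... | tri≈ _ m≡n _ = m≡n
    ... | tri> _ _ n<m = ⊥-elim (≺-irrefl (sym eq) (orbit-increasing n<m))

    orbitRay : Ray X
    orbitRay = record { vtx = orbit ; inj = orbit-injective ; adj = λ n → ~f (orbit n) }

  module NestedConnected
    (C : ℕ → Pred V 0ℓ)
    (C₀ : ∀ v → C 0 v)
    (shrinks : ∀ k → C (suc k) ⊆ C k)
    (connected : ∀ k → IsConnected (C k))
    (nonempty : ∀ k → ∃ (C k))
    (vanishes : ∀ v → ∃ λ k → ¬ C k v)
    where

    eventually-avoids : ∀ L → ∃ λ K → ∀ {v} → C K v → v ∉ L
    eventually-avoids [] = 0 , λ _ ()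
    eventually-avoids (a ∷ L) with vanishes a | eventually-avoids L
    ... | k , ¬ca | K , avoids = k + K , avoids′
      where
      avoids′ : ∀ {v} → C (k + K) v → v ∉ a ∷ L
      avoids′ c (here refl) = ¬ca (antitone C shrinks (m≤m+n k K) c)
      avoids′ c (there v∈L) = avoids (antitone C shrinks (m≤n+m K k) c) v∈L

    opaque
      level-spec : ∀ v → ∃ λ m → C m v × ¬ C (suc m) v
      level-spec v = lastBefore (λ k → C k v) (C₀ v) _ (proj₂ (vanishes v))

    level : V → ℕ
    level v = proj₁ (level-spec v)

    ∈-level : ∀ v → C (level v) v
    ∈-level v = proj₁ (proj₂ (level-spec v))

    ∉-suc-level : ∀ v → ¬ C (suc (level v)) v
    ∉-suc-level v = proj₂ (proj₂ (level-spec v))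

    level-max : ∀ {k v} → C k v → k ≤ level v
    level-max {k} {v} ckv with k ≤? level v
    ... | yes k≤ = k≤
    ... | no k≰ = ⊥-elim (∉-suc-level v (antitone C shrinks (≰⇒> k≰) ckv))

    Descends : V → ℕ → Set
    Descends v n = Reaches (C (level v)) (C (suc (level v))) n v

    descends : ∀ v → ∃ (Descends v)
    descends v with nonempty (suc (level v))
    ... | c , cc = WalkIn⇒Reaches (connected (level v) (∈-level v) (shrinks _ cc)) cc

    opaque
      shortest : ∀ v → ∃ λ n → Descends v n × (∀ {k} → k < n → ¬ Descends v k)
      shortest v = least (Descends v) _ (proj₂ (descends v))

    distance : V → ℕ
    distance v = proj₁ (shortest v)

    next-spec : ∀ v → Σ V λ w → v ~ w × ∃ λ m → suc m ≡ distance v ×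
                      Reaches (C (level v)) (C (suc (level v))) m w
    next-spec v = Reaches-advance (proj₁ (proj₂ (shortest v))) (∉-suc-level v)

    next : V → V
    next v = proj₁ (next-spec v)

    ~next : ∀ v → v ~ next v
    ~next v = proj₁ (proj₂ (next-spec v))

    level-next : ∀ v → level v ≤ level (next v)
    level-next v with next-spec v
    ... | _ , _ , _ , _ , reaches = level-max (Reaches-source (shrinks _) reaches)

    potential : V → ℕ × ℕ
    potential v = level v , distance v

    -- A greedy step either raises the level or shortens the distance to the next
    -- level: the potential grows in the lexicographic order with distance reversed.
    _≺_ : Rel V 0ℓ
    _≺_ = ×-Lex _≡_ _<_ _>_ on potential

    ≺next : ∀ v → v ≺ next v
    ≺next v with m≤n⇒m<n∨m≡n (level-next v)
    ... | inj₁ lt = inj₁ lt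
    ... | inj₂ eq with proj₂ (proj₂ (next-spec v))
    ...   | m , suc-m≡d , reaches = inj₂ (eq , subst (distance (next v) <_) suc-m≡d (s≤s shorter))
      where
      shorter : distance (next v) ≤ m
      shorter = ≮⇒≥ λ m<d → proj₂ (proj₂ (shortest (next v))) m<d
                  (subst (λ l → Reaches (C l) (C (suc l)) m (next v)) eq reaches)

    ≺-trans : Transitive _≺_
    ≺-trans {u} {v} {w} =
      ×-transitive {_<₂_ = _>_} isEquivalence <-resp₂-≡ <-trans (λ i>j j>k → <-trans j>k i>j)
        {potential u} {potential v} {potential w}

    ≺-irrefl : Irreflexive _≡_ _≺_
    ≺-irrefl {u} refl =
      ×-irreflexive {_≈₁_ = _≡_} {_<₁_ = _<_} {_≈₂_ = _≡_} {_<₂_ = _>_}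
        <-irrefl (λ eq → <-irrefl (sym eq)) {potential u} {potential u} (refl , refl)

    open Orbit ≺-trans ≺-irrefl next ~next ≺next (proj₁ (nonempty 0))

    level-orbit-mono : ∀ {m n} → m ≤ n → level (orbit m) ≤ level (orbit n)
    level-orbit-mono {m} =
      inductionFrom (λ n → level (orbit m) ≤ level (orbit n)) ≤-refl
        (λ {n} _ le → ≤-trans le (level-next (orbit n)))

    level-rises : ∀ d n → distance (orbit n) ≤ d → ∃ λ N → level (orbit n) < level (orbit N)
    level-rises d n d≤ with ≺next (orbit n)
    ... | inj₁ lt = suc n , lt
    level-rises zero n d≤ | inj₂ (_ , dist<) = ⊥-elim (n≮0 (<-≤-trans dist< d≤))
    level-rises (suc d) n d≤ | inj₂ (eq , dist<)
      with level-rises d (suc n) (≤-pred (<-≤-trans dist< d≤))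
    ... | N , lt = N , subst (_< level (orbit N)) (sym eq) lt

    level-unbounded : ∀ k → ∃ λ N → k ≤ level (orbit N)
    level-unbounded zero = 0 , z≤n
    level-unbounded (suc k) with level-unbounded k
    ... | N , k≤ with level-rises _ N ≤-refl
    ... | N′ , lt = N′ , ≤-<-trans k≤ lt

    ray : Ray X
    ray = orbitRay

    ray-LiesIn : ∀ k → LiesIn X ray (C k)
    ray-LiesIn k with level-unbounded k
    ... | N , k≤ = N , λ n N≤n →
      antitone C shrinks (≤-trans k≤ (level-orbit-mono N≤n)) (∈-level (orbit n))

module Compactness (em : ExcludedMiddle 0ℓ) (em₁ : ExcludedMiddle (lsuc 0ℓ))
                   (X : Graph) (conn : Connected X)
                   (I : Set) (𝒰 : I → Point X → Set₁) (𝒰-open : ∀ i → IsOpen X (𝒰 i))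
                   (𝒰-covers : ∀ p → ∃ λ i → 𝒰 i p) where
  open Graph X
  open ClassicalGraph em X

  private
    dne₁ : ∀ {P : Set₁} → ¬ ¬ P → P
    dne₁ = em⇒dne em₁

  Covered : Pred V 0ℓ → Set₁
  Covered A = Σ (List I) λ is → ∀ p → InBasic X A p → Any (λ i → 𝒰 i p) is

  InBasic-mono : ∀ {A B} → A ⊆ B → ∀ p → InBasic X A p → InBasic X B p
  InBasic-mono A⊆B (inj₁ v) (lift av) = lift (A⊆B av)
  InBasic-mono {A} {B} A⊆B (inj₂ r) end = EndIn-mono r {A} {B} A⊆B end

  InBasic-U : ∀ p → InBasic X U p
  InBasic-U (inj₁ v) = lift tt
  InBasic-U (inj₂ r) _ _ = 0 , λ _ _ → tt

  covered-⊆ : ∀ {A B} → A ⊆ B → Covered B → Covered A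
  covered-⊆ A⊆B (is , cover) = is , λ p p∈A → cover p (InBasic-mono A⊆B p p∈A)

  covered-∅ : Covered ∅
  covered-∅ = [] , λ
    { (inj₁ v) (lift ())
    ; (inj₂ r) end → ⊥-elim (proj₂ (LiesIn-witness r {∅} (EndIn⇒LiesIn r {∅} end))) }

  covered-∪ : ∀ {A B} → FiniteBoundary X A → Covered A → Covered B → Covered (A ∪ B)
  covered-∪ {A} {B} b (is , coverA) (js , coverB) = is ++ js , cover
    where
    only-B : (A ∪ B) ∩ ∁ A ⊆ B
    only-B (inj₁ a , ¬a) = ⊥-elim (¬a a)
    only-B (inj₂ b , _) = b

    cover : ∀ p → InBasic X (A ∪ B) p → Any (λ i → 𝒰 i p) (is ++ js)
    cover (inj₁ v) (lift (inj₁ a)) = ++⁺ˡ (coverA (inj₁ v) (lift a))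
    cover (inj₁ v) (lift (inj₂ b)) = ++⁺ʳ is (coverB (inj₁ v) (lift b))
    cover (inj₂ r) end with end-side r {A} b
    ... | inj₁ endA = ++⁺ˡ (coverA (inj₂ r) endA)
    ... | inj₂ end∁A = ++⁺ʳ is (coverB (inj₂ r)
            (EndIn-mono r {(A ∪ B) ∩ ∁ A} {B} only-B (EndIn-∩ r {A ∪ B} {∁ A} end end∁A)))

  covered-⋃ᴸ : ∀ {J : Set} (f : J → Pred V 0ℓ) → (∀ j → FiniteBoundary X (f j)) →
               (∀ j → Covered (f j)) → ∀ js → Covered (⋃ᴸ f js)
  covered-⋃ᴸ f b cover [] = covered-∅
  covered-⋃ᴸ f b cover (j ∷ js) = covered-∪ (b j) (cover j) (covered-⋃ᴸ f b cover js)

  uncovered⇒nonempty : ∀ {A} → ¬ Covered A → ∃ A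
  uncovered⇒nonempty unc = em⇒dne em λ empty → unc (covered-⊆ (λ a → empty (_ , a)) covered-∅)

  uncovered-component : ∀ {C W r} → FiniteBoundary X C → ¬ Covered C →
                        FiniteBoundary X W → Covered W → W r →
                        ∃ λ u → ¬ Covered (Component (C ∖ W) u)
  uncovered-component {C} {W} {r} bC uncC bW coverW wr = dne₁ λ none →
    uncC (covered-⊆ C⊆ (covered-∪ bW coverW
      (covered-⋃ᴸ (Component A) (λ _ → FiniteBoundary-Component bA)
        (λ u → dne₁ λ unc → none (u , unc)) (innerBoundary bA))))
    where
    A = C ∖ W
    bA = FiniteBoundary-∩ bC (FiniteBoundary-∁ bW)

    C⊆ : C ⊆ W ∪ ⋃ᴸ (Component A) (innerBoundary bA)
    C⊆ {v} cv with em {W v}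
    ... | yes wv = inj₁ wv
    ... | no ¬wv = inj₂ (⊆-⋃-Component conn bA (λ ar → proj₂ ar wr) (cv , ¬wv))

  record Neighbourhood (p : Point X) : Set₁ where
    field
      set : Pred V 0ℓ
      finiteBoundary : FiniteBoundary X set
      ∋p : InBasic X set p
      covered : Covered set

  neighbourhood : ∀ p → Neighbourhood p
  neighbourhood p with 𝒰-covers p
  ... | i , p∈𝒰ᵢ with 𝒰-open i p p∈𝒰ᵢ
  ... | e , b , ∋p , e⊆𝒰ᵢ = record
    { set = e ; finiteBoundary = b ; ∋p = ∋p ; covered = i ∷ [] , λ q q∈e → here (e⊆𝒰ᵢ q q∈e) }

  module _ (v : V) where
    open Neighbourhood (neighbourhood (inj₁ v)) public using ()
      renaming (set to Nbhd; finiteBoundary to Nbhd-finiteBoundary; covered to Nbhd-covered)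

  ∈-Nbhd : ∀ v → Nbhd v v
  ∈-Nbhd v with Neighbourhood.∋p (neighbourhood (inj₁ v))
  ... | lift nv = nv

  record Piece : Set₁ where
    field
      set : Pred V 0ℓ
      finiteBoundary : FiniteBoundary X set
      connected : IsConnected set
      uncovered : ¬ Covered set

  whole : ¬ Covered U → Piece
  whole uncovered = record
    { set = U
    ; finiteBoundary = [] , λ _ _ _ _ ¬⊤ → ⊥-elim (¬⊤ tt)
    ; connected = λ _ _ → Walk⇒WalkIn (conn _ _)
    ; uncovered = uncovered
    }

  refine : ∀ {W r} → FiniteBoundary X W → Covered W → W r → Piece → Piece
  refine {W} bW coverW wr P = record
    { set = Component (set ∖ W) (proj₁ split)
    ; finiteBoundary =
        FiniteBoundary-Component (FiniteBoundary-∩ finiteBoundary (FiniteBoundary-∁ bW))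
    ; connected = Component-connected
    ; uncovered = proj₂ split
    }
    where
    open Piece P
    split = uncovered-component finiteBoundary uncovered bW coverW wr

  module Exhaustion (root : V) where

    Ball : ℕ → Pred V 0ℓ
    Ball-finiteBoundary : ∀ k → FiniteBoundary X (Ball k)

    Ball zero = Nbhd root
    Ball (suc k) = Ball k ∪ ⋃ᴸ Nbhd (outerBoundary (Ball-finiteBoundary k))

    Ball-finiteBoundary zero = Nbhd-finiteBoundary root
    Ball-finiteBoundary (suc k) =
      FiniteBoundary-∪ (Ball-finiteBoundary k)
        (FiniteBoundary-⋃ᴸ Nbhd Nbhd-finiteBoundary (outerBoundary (Ball-finiteBoundary k)))

    Ball-covered : ∀ k → Covered (Ball k)
    Ball-covered zero = Nbhd-covered root
    Ball-covered (suc k) =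
      covered-∪ (Ball-finiteBoundary k) (Ball-covered k)
        (covered-⋃ᴸ Nbhd Nbhd-finiteBoundary Nbhd-covered (outerBoundary (Ball-finiteBoundary k)))

    root-∈-Ball : ∀ k → Ball k root
    root-∈-Ball zero = ∈-Nbhd root
    root-∈-Ball (suc k) = inj₁ (root-∈-Ball k)

    Ball-neighbour : ∀ k {x y} → Ball k x → x ~ y → Ball (suc k) y
    Ball-neighbour k {x} {y} bx x~y with em {Ball k y}
    ... | yes by = inj₁ by
    ... | no ¬by =
      inj₂ (∈-⋃ᴸ Nbhd (outerBoundary-∈ (Ball-finiteBoundary k) x~y bx ¬by) (∈-Nbhd y))

    Ball-exhausts : ∀ {v} → Walk X v root → ∃ λ k → Ball k v
    Ball-exhausts stop = 0 , ∈-Nbhd root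
    Ball-exhausts (step v~w w) with Ball-exhausts w
    ... | k , bw = suc k , Ball-neighbour k bw (~-sym v~w)

  module Chain (root : V) (uncovered : ¬ Covered U) where
    open Exhaustion root

    pieces : ℕ → Piece
    pieces zero = whole uncovered
    pieces (suc k) = refine (Ball-finiteBoundary k) (Ball-covered k) (root-∈-Ball k) (pieces k)

    C : ℕ → Pred V 0ℓ
    C k = Piece.set (pieces k)

    C-shrinks : ∀ k → C (suc k) ⊆ C k
    C-shrinks k c = proj₁ (Component-⊆ c)

    C-vanishes : ∀ v → ∃ λ k → ¬ C k v
    C-vanishes v with Ball-exhausts (conn v root)
    ... | k , bv = suc k , λ c → proj₂ (Component-⊆ c) bv

    open NestedConnected C (λ _ → tt) C-shrinks (λ k → Piece.connected (pieces k))
           (λ k → uncovered⇒nonempty (Piece.uncovered (pieces k))) C-vanishes public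

    no-ray-through : (r : Ray X) → (∀ k → LiesIn X r (C k)) → ⊥
    no-ray-through r r-LiesIn = Piece.uncovered (pieces K) (covered-⊆ CK⊆e covered)
      where
      open Neighbourhood (neighbourhood (inj₂ r))
      avoiding = eventually-avoids (innerBoundary finiteBoundary)
      K = proj₁ avoiding
      meet : ∃ (C K ∩ set)
      meet = LiesIn-witness r {C K ∩ set}
               (LiesIn-∩ r {C K} {set} (r-LiesIn K) (EndIn⇒LiesIn r {set} ∋p))
      CK⊆e : C K ⊆ set
      CK⊆e = connected-⊆ (Piece.connected (pieces K)) finiteBoundary (proj₂ avoiding)
               (proj₁ (proj₂ meet)) (proj₂ (proj₂ meet))

  U-covered : Covered U
  U-covered = dne₁ λ uncovered →
    let open Chain (proj₁ (uncovered⇒nonempty uncovered)) uncovered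
    in no-ray-through ray ray-LiesIn

theorem2 : ExcludedMiddle 0ℓ → ExcludedMiddle (lsuc 0ℓ) →
    (X : Graph) → Connected X → EdgeTopologyCompact X
theorem2 em em₁ X conn I 𝒰 𝒰-open 𝒰-covers = is , λ p → cover p (InBasic-U p)
  where
  open Compactness em em₁ X conn I 𝒰 𝒰-open 𝒰-covers
  is = proj₁ U-covered
  cover = proj₂ U-covered
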